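{- For any digraph $D$ of order $n$, $dib(D)\leq n-\beta(D)+1$.
   Context: All digraphs are finite, loopless, and simple: $D=(V,A)$ where $A$ is a set of ordered pairs $uv$ (darts) of distinct vertices; both $uv$ and $vu$ may be darts. An independent set is a set $I$ of vertices such that no dart joins two vertices of $I$; $\beta(D)$ is the maximum size of an independent set. A coloring of $D$ with $k$ colors is a surjective map $\varsigma:V\to\{1,\dots,k\}$; it is acyclic if each color class induces a subdigraph with no directed cycle. With respect to $\varsigma$, a vertex $u$ is a $b^+$-vertex if for every color $j\neq\varsigma(u)$ there is a dart $uw$ with $\varsigma(w)=j$, and a $b^-$-vertex if for every color $j\neq \varsigma(u)$ there is a dart $wu$ with $\varsigma(w)=j$. A $b$-coloring is a coloring in which every color class contains a $b^+$-vertex and a $b^-$-vertex. The dib-chromatic number $dib(D)$ is the largest $k$ such that $D$ admits an acyclic $b$-coloring with $k$ colors. -}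

module Defs where

open import Data.Nat using (ℕ; zero; suc)
open import Data.Bool using (Bool; T)
open import Data.Fin using (Fin; zero; suc; inject₁; fromℕ)
open import Data.Fin.Subset using (Subset; _∈_)
open import Data.Product using (Σ; ∃; _×_)
open import Relation.Nullary using (¬_)
open import Relation.Binary.PropositionalEquality using (_≡_; _≢_)
open import Function.Definitions using (Injective)

record Digraph (n : ℕ) : Set where
  field
    adj      : Fin n → Fin n → Bool
    loopless : ∀ u → ¬ T (adj u u)

  Dart : Fin n → Fin n → Set
  Dart u v = T (adj u v)

open Digraph public

module _ {n : ℕ} (D : Digraph n) where

  Independent : Subset n → Set
  Independent I = ∀ u v → u ∈ I → v ∈ I → ¬ Dart D u v

  Surjective : {k : ℕ} → (Fin n → Fin k) → Set
  Surjective {k} c = ∀ (j : Fin k) → ∃ λ u → c u ≡ j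

  -- a directed cycle of length m+2 (pairwise distinct vertices
  -- v₀ → v₁ → … → v_{m+1} → v₀) all of whose vertices have colour i
  MonochromaticCycle : {k : ℕ} → (Fin n → Fin k) → Fin k → Set
  MonochromaticCycle c i =
    Σ ℕ λ m → Σ (Fin (suc (suc m)) → Fin n) λ f →
      Injective _≡_ _≡_ f
      × (∀ t → c (f t) ≡ i)
      × (∀ (t : Fin (suc m)) → Dart D (f (inject₁ t)) (f (suc t)))
      × Dart D (f (fromℕ (suc m))) (f zero)

  Acyclic : {k : ℕ} → (Fin n → Fin k) → Set
  Acyclic {k} c = ∀ (i : Fin k) → ¬ MonochromaticCycle c i

  IsBPlus : {k : ℕ} → (Fin n → Fin k) → Fin n → Set
  IsBPlus {k} c u = ∀ (j : Fin k) → j ≢ c u → ∃ λ w → Dart D u w × c w ≡ j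

  IsBMinus : {k : ℕ} → (Fin n → Fin k) → Fin n → Set
  IsBMinus {k} c u = ∀ (j : Fin k) → j ≢ c u → ∃ λ w → Dart D w u × c w ≡ j

  IsBColoring : {k : ℕ} → (Fin n → Fin k) → Set
  IsBColoring {k} c =
    Surjective c
    × (∀ (i : Fin k) → (∃ λ u → c u ≡ i × IsBPlus c u)
                     × (∃ λ u → c u ≡ i × IsBMinus c u))

  HasAcyclicBColoring : ℕ → Set
  HasAcyclicBColoring k = Σ (Fin n → Fin k) λ c → IsBColoring c × Acyclic c

{-# OPTIONS --safe #-}
-- Choose a b⁺-vertex of every colour. If one of them, u, lies in the
-- independent set I, then its out-neighbours of the k − 1 other colours are
-- pairwise distinct and, by independence, lie outside I. Otherwise the k
-- chosen vertices themselves are pairwise distinct and lie outside I. Either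
-- way at least k − 1 vertices avoid I.
module Submission where

open import Defs
open import Data.Nat using (ℕ; zero; suc; _+_; _∸_; _≤_; z≤n; s≤s)
open import Data.Nat.Properties
  using (m≤n⇒m≤1+n; <⇒≤; m∸n+n≡m; +-monoˡ-≤; module ≤-Reasoning)
open import Data.Fin using (Fin; zero; suc; punchIn; punchOut; _≟_)
open import Data.Fin.Properties
  using (¬Fin0; any?; punchIn-injective; punchInᵢ≢i; punchOut-injective; punchIn-punchOut)
open import Data.Fin.Subset using (Subset; ∣_∣; inside; outside; _∈_; _∉_; ∁)
open import Data.Fin.Subset.Properties
  using (_∈?_; ∣p∣≤n; drop-there; x∉p⇒x∈∁p; ∣∁p∣≡n∸∣p∣)
open import Data.Vec using (_∷_; [])
open import Data.Product using (∃; _×_; _,_; proj₁; proj₂)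
open import Data.Empty using (⊥-elim)
open import Relation.Nullary using (yes; no)
open import Relation.Binary.PropositionalEquality
open import Function using (_∘_; id)
open import Function.Definitions using (Injective)

private
  variable
    m n : ℕ

module _ {A B C : Set} {g : A → B} {f : A → C} (c : B → C) where

  injective-via : (∀ x → c (g x) ≡ f x) → Injective _≡_ _≡_ f → Injective _≡_ _≡_ g
  injective-via c∘g≗f f-inj {x} {y} gx≡gy = f-inj (begin
    f x      ≡⟨ sym (c∘g≗f x) ⟩
    c (g x)  ≡⟨ cong c gx≡gy ⟩
    c (g y)  ≡⟨ c∘g≗f y ⟩
    f y      ∎)
    where open ≡-Reasoning

mutual

  injective-into⇒≤∣∣ : (p : Subset n) {g : Fin m → Fin n} →
                       Injective _≡_ _≡_ g → (∀ x → g x ∈ p) → m ≤ ∣ p ∣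
  injective-into⇒≤∣∣ {m = zero} _ _ _ = z≤n
  injective-into⇒≤∣∣ {m = suc m} [] {g} _ _ = ⊥-elim (¬Fin0 (g zero))
  injective-into⇒≤∣∣ (outside ∷ p) {g} g-inj g∈p =
    injective-missing-zero⇒≤∣∣ p g-inj 0≢g g∈p
    where
    0≢g : ∀ x → zero ≢ g x
    0≢g x 0≡gx with subst (_∈ outside ∷ p) (sym 0≡gx) (g∈p x)
    ... | ()
  injective-into⇒≤∣∣ {m = suc _} (inside ∷ p) {g} g-inj g∈p with any? (λ x → zero ≟ g x)
  ... | no 0∉img =
    m≤n⇒m≤1+n (injective-missing-zero⇒≤∣∣ p g-inj (λ x 0≡gx → 0∉img (x , 0≡gx)) g∈p)
  ... | yes (x₀ , 0≡gx₀) =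
    s≤s (injective-missing-zero⇒≤∣∣ p g∘punchIn-inj 0≢g∘punchIn (g∈p ∘ punchIn x₀))
    where
    g∘punchIn-inj : Injective _≡_ _≡_ (g ∘ punchIn x₀)
    g∘punchIn-inj = punchIn-injective x₀ _ _ ∘ g-inj

    0≢g∘punchIn : ∀ x → zero ≢ g (punchIn x₀ x)
    0≢g∘punchIn x 0≡g[x] = punchInᵢ≢i x₀ x (g-inj (trans (sym 0≡g[x]) 0≡gx₀))

  injective-missing-zero⇒≤∣∣ : ∀ {b} (p : Subset n) {g : Fin m → Fin (suc n)} →
                               Injective _≡_ _≡_ g → (∀ x → zero ≢ g x) →
                               (∀ x → g x ∈ b ∷ p) → m ≤ ∣ p ∣
  injective-missing-zero⇒≤∣∣ {n} {m} {b} p {g} g-inj 0≢g g∈p =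
    injective-into⇒≤∣∣ p g′-inj (λ x → drop-there (subst (_∈ b ∷ p) (sym (suc-g′ x)) (g∈p x)))
    where
    g′ : Fin m → Fin n
    g′ x = punchOut (0≢g x)

    suc-g′ : ∀ x → suc (g′ x) ≡ g x
    suc-g′ x = punchIn-punchOut (0≢g x)

    g′-inj : Injective _≡_ _≡_ g′
    g′-inj {x} {y} = g-inj ∘ punchOut-injective (0≢g x) (0≢g y)

injective-avoiding⇒+∣∣≤ : (I : Subset n) {g : Fin m → Fin n} →
                          Injective _≡_ _≡_ g → (∀ x → g x ∉ I) → m + ∣ I ∣ ≤ n
injective-avoiding⇒+∣∣≤ {n} {m} I g-inj g∉I = begin
  m + ∣ I ∣          ≤⟨ +-monoˡ-≤ ∣ I ∣ m≤∣∁I∣ ⟩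
  ∣ ∁ I ∣ + ∣ I ∣    ≡⟨ cong (_+ ∣ I ∣) (∣∁p∣≡n∸∣p∣ I) ⟩
  n ∸ ∣ I ∣ + ∣ I ∣  ≡⟨ m∸n+n≡m (∣p∣≤n I) ⟩
  n                  ∎
  where
  open ≤-Reasoning
  m≤∣∁I∣ : m ≤ ∣ ∁ I ∣
  m≤∣∁I∣ = injective-into⇒≤∣∣ (∁ I) g-inj (x∉p⇒x∈∁p ∘ g∉I)

module _ (D : Digraph n) {k : ℕ} {c : Fin n → Fin (suc k)} {I : Subset n} where

  b⁺-vertex-in-independent⇒+∣∣≤ : Independent D I → ∀ {u} → u ∈ I → IsBPlus D c u →
                                  k + ∣ I ∣ ≤ n
  b⁺-vertex-in-independent⇒+∣∣≤ indep {u} u∈I b⁺ =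
    injective-avoiding⇒+∣∣≤ I
      (injective-via c (λ j → proj₂ (proj₂ (out-neighbour j))) (punchIn-injective (c u) _ _))
      (λ j w∈I → indep u (neighbour j) u∈I w∈I (proj₁ (proj₂ (out-neighbour j))))
    where
    out-neighbour : ∀ j → ∃ λ w → Dart D u w × c w ≡ punchIn (c u) j
    out-neighbour j = b⁺ (punchIn (c u) j) (punchInᵢ≢i (c u) j)

    neighbour : Fin k → Fin n
    neighbour = proj₁ ∘ out-neighbour

  b⁺-vertices⇒+∣∣≤ : Independent D I → (∀ i → ∃ λ u → c u ≡ i × IsBPlus D c u) →
                     k + ∣ I ∣ ≤ n
  b⁺-vertices⇒+∣∣≤ indep b⁺-vertex with any? (λ i → proj₁ (b⁺-vertex i) ∈? I)
  ... | yes (i , uᵢ∈I) =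
    b⁺-vertex-in-independent⇒+∣∣≤ indep uᵢ∈I (proj₂ (proj₂ (b⁺-vertex i)))
  ... | no none∈I =
    <⇒≤ (injective-avoiding⇒+∣∣≤ I
      (injective-via c (proj₁ ∘ proj₂ ∘ b⁺-vertex) id)
      (λ i uᵢ∈I → none∈I (i , uᵢ∈I)))

corollary3 : ∀ (n : ℕ) (D : Digraph n) (k : ℕ) (I : Subset n)
    → HasAcyclicBColoring D k → Independent D I
    → k + ∣ I ∣ ≤ suc n
corollary3 n D zero I _ _ = m≤n⇒m≤1+n (∣p∣≤n I)
corollary3 n D (suc k) I (c , (_ , b-vertices) , _) indep =
  s≤s (b⁺-vertices⇒+∣∣≤ D indep (proj₁ ∘ b-vertices))
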